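{- Let $k\ge2$ and $q_1,q_2\ge1$ be integers and let $m$ be a number. If $\mathcal P_0\in\mathcal P(k;m,q_1)$ and $\gamma_2=\begin{pmatrix}a&b\\c&d\end{pmatrix}\in\Gamma_0(q_1q_2)$, then $\mathcal P_0|_{2-k}\gamma_2\in\mathcal P(k;m,q_1)$.
   Context: $\mathcal P(k;m,q)=\{\sum_{n=0}^{k-2}a_nx^{k-n-2}\in\mathbb Q[x]: q^{n+1}a_n\in m\mathbb Z\text{ for all }n\}$, where $m\mathbb Z=\{mt:t\in\mathbb Z\}$. For a polynomial $\mathcal P_0(x)=\sum_{n=0}^{k-2}a_nx^{k-n-2}$, the slash is $\mathcal P_0|_{2-k}\gamma_2(x)=(cx+d)^{k-2}\mathcal P_0\!\left(\frac{ax+b}{cx+d}\right)=\sum_{n=0}^{k-2}a_n(cx+d)^n(ax+b)^{k-n-2}$. -}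

module Defs where

open import Data.Nat as ℕ using (ℕ; zero; suc; _∸_)
open import Data.Integer as ℤ using (ℤ; +_)
open import Data.Rational using (ℚ; 0ℚ; 1ℚ; _/_; _+_; _*_)
open import Data.List using (List; []; _∷_)
open import Data.Product using (∃)
open import Relation.Binary.PropositionalEquality using (_≡_)

ℤtoℚ : ℤ → ℚ
ℤtoℚ z = z / 1

_^ℚ_ : ℚ → ℕ → ℚ
x ^ℚ zero = 1ℚ
x ^ℚ suc n = x * (x ^ℚ n)

-- Polynomials in ℚ[x], as lists of coefficients in ASCENDING degree order:
-- (c₀ ∷ c₁ ∷ …) represents c₀ + c₁ x + … .
Poly : Set
Poly = List ℚ

coeff : Poly → ℕ → ℚ
coeff []       _       = 0ℚ
coeff (c ∷ p) zero    = c
coeff (c ∷ p) (suc j) = coeff p j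

_+ₚ_ : Poly → Poly → Poly
[]      +ₚ q       = q
(a ∷ p) +ₚ []      = a ∷ p
(a ∷ p) +ₚ (b ∷ q) = (a + b) ∷ (p +ₚ q)

scaleₚ : ℚ → Poly → Poly
scaleₚ c []      = []
scaleₚ c (a ∷ p) = (c * a) ∷ scaleₚ c p

_*ₚ_ : Poly → Poly → Poly
[]      *ₚ q = []
(a ∷ p) *ₚ q = scaleₚ a q +ₚ (0ℚ ∷ (p *ₚ q))

constₚ : ℚ → Poly
constₚ c = c ∷ []

_^ₚ_ : Poly → ℕ → Poly
p ^ₚ zero  = constₚ 1ℚ
p ^ₚ suc n = p *ₚ (p ^ₚ n)

linₚ : ℤ → ℤ → Poly
linₚ u v = ℤtoℚ v ∷ ℤtoℚ u ∷ []

-- Writing P₀(x) = Σ_{n=0}^{k-2} a_n x^{k-n-2}, the paper's a_n is the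
-- coefficient of x^{k-2-n}.
aCoeff : ℕ → Poly → ℕ → ℚ
aCoeff k p n = coeff p ((k ∸ 2) ∸ n)

sumTo : ℕ → (ℕ → Poly) → Poly
sumTo zero    f = f zero
sumTo (suc N) f = sumTo N f +ₚ f (suc N)

InP : ℕ → ℚ → ℕ → Poly → Set
InP k m q p =
  (∀ j → (k ∸ 2) ℕ.< j → coeff p j ≡ 0ℚ) ×ₛ
  (∀ n → n ℕ.≤ (k ∸ 2) →
     ∃ λ (t : ℤ) → (ℤtoℚ (+ q) ^ℚ suc n) * aCoeff k p n ≡ m * ℤtoℚ t)
  where
  open import Data.Product renaming (_×_ to _×ₛ_)

slash : ℕ → Poly → ℤ → ℤ → ℤ → ℤ → Poly
slash k p a b c d =
  sumTo (k ∸ 2) λ n →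
    scaleₚ (aCoeff k p n) ((linₚ c d ^ₚ n) *ₚ (linₚ a b ^ₚ ((k ∸ 2) ∸ n)))

InΓ₀ : ℕ → ℤ → ℤ → ℤ → ℤ → Set
InΓ₀ N a b c d = (a ℤ.* d ℤ.- b ℤ.* c ≡ + 1) ×ₛ ((+ N) ∣ c)
  where
  open import Data.Product renaming (_×_ to _×ₛ_)
  open import Data.Integer.Divisibility using (_∣_)

{-# OPTIONS --safe #-}
-- Put ρ = q₁ and K = k - 2. For a polynomial P of degree at most D, evaluate its degree-D
-- homogenisation at y = ρ, giving Σₑ ρ^(D-e) cₑ xᵉ. This is multiplicative in (P, D); as ρ ∣ c it
-- sends cx + d to cx + ρd ∈ ρℤ[x], and it sends ax + b to ax + ρb ∈ ℤ[x]. So the n-th basis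
-- polynomial (cx+d)ⁿ(ax+b)^(K-n) lands in ρⁿℤ[x] in degree K, hence in ρⁿ⁺¹ℤ[x] in degree K+1,
-- and multiplying by aₙ, with ρⁿ⁺¹aₙ ∈ mℤ, puts every term of the slash into mℤ[x]. In degree
-- K+1 the coefficient of x^(K-n) is weighted by exactly ρⁿ⁺¹, which is the condition defining 𝒫.
module Submission where

open import Defs
open import Data.Nat using (ℕ; _≤_; _*_)
open import Data.Integer using (ℤ)
open import Data.Rational using (ℚ)

open import Data.Nat using (zero; suc; _∸_; _<_; z≤n; s≤s)
import Data.Nat as ℕ
import Data.Nat.Properties as ℕ
import Data.Nat.Divisibility as ℕ
open import Data.Integer using (+_)
import Data.Integer as ℤ
import Data.Integer.Properties as ℤ
open import Data.Integer.Divisibility.Signed using (_∣_; divides; ∣ᵤ⇒∣)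
open import Data.Rational using (0ℚ; 1ℚ; _+_; toℚᵘ) renaming (_*_ to _·_)
import Data.Rational.Properties as ℚ
open import Data.Rational.Unnormalised using (mkℚᵘ; *≡*) renaming (_≃_ to _≃ᵘ_)
import Data.Rational.Unnormalised as ℚᵘ
import Data.Rational.Unnormalised.Properties as ℚᵘ
open import Algebra.Bundles using (CommutativeRing)
open import Algebra.Properties.CommutativeSemigroup
  (CommutativeRing.*-commutativeSemigroup ℚ.+-*-commutativeRing)
  using (x∙yz≈y∙xz; x∙yz≈z∙yx)
open import Data.List using ([]; _∷_)
open import Data.Product using (_,_; ∃)
open import Relation.Nullary using (yes; no)
open import Relation.Binary.PropositionalEquality

private
  variable
    ρ r r′ a : ℚ
    D D₁ D₂ n : ℕ
    P R : Poly

toℚᵘ-ℤtoℚ : ∀ z → toℚᵘ (ℤtoℚ z) ≃ᵘ mkℚᵘ z 0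
toℚᵘ-ℤtoℚ z = ℚ.toℚᵘ-fromℚᵘ (mkℚᵘ z 0)

ℤtoℚ-homo-+ : ∀ u v → ℤtoℚ (u ℤ.+ v) ≡ ℤtoℚ u + ℤtoℚ v
ℤtoℚ-homo-+ u v = ℚ.toℚᵘ-injective (begin
  toℚᵘ (ℤtoℚ (u ℤ.+ v))              ≈⟨ toℚᵘ-ℤtoℚ (u ℤ.+ v) ⟩
  mkℚᵘ (u ℤ.+ v) 0                    ≈⟨ *≡* (cong (ℤ._* ℤ.1ℤ) unit-denominators) ⟨
  mkℚᵘ u 0 ℚᵘ.+ mkℚᵘ v 0              ≈⟨ ℚᵘ.+-cong (toℚᵘ-ℤtoℚ u) (toℚᵘ-ℤtoℚ v) ⟨
  toℚᵘ (ℤtoℚ u) ℚᵘ.+ toℚᵘ (ℤtoℚ v)    ≈⟨ ℚ.toℚᵘ-homo-+ (ℤtoℚ u) (ℤtoℚ v) ⟨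
  toℚᵘ (ℤtoℚ u + ℤtoℚ v)              ∎)
  where
  open ℚᵘ.≃-Reasoning
  unit-denominators : u ℤ.* ℤ.1ℤ ℤ.+ v ℤ.* ℤ.1ℤ ≡ u ℤ.+ v
  unit-denominators = cong₂ ℤ._+_ (ℤ.*-identityʳ u) (ℤ.*-identityʳ v)

ℤtoℚ-homo-* : ∀ u v → ℤtoℚ (u ℤ.* v) ≡ ℤtoℚ u · ℤtoℚ v
ℤtoℚ-homo-* u v = ℚ.toℚᵘ-injective (begin
  toℚᵘ (ℤtoℚ (u ℤ.* v))              ≈⟨ toℚᵘ-ℤtoℚ (u ℤ.* v) ⟩
  mkℚᵘ u 0 ℚᵘ.* mkℚᵘ v 0              ≈⟨ ℚᵘ.*-cong (toℚᵘ-ℤtoℚ u) (toℚᵘ-ℤtoℚ v) ⟨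
  toℚᵘ (ℤtoℚ u) ℚᵘ.* toℚᵘ (ℤtoℚ v)    ≈⟨ ℚ.toℚᵘ-homo-* (ℤtoℚ u) (ℤtoℚ v) ⟨
  toℚᵘ (ℤtoℚ u · ℤtoℚ v)              ∎)
  where open ℚᵘ.≃-Reasoning

^ℚ-+ : ∀ y i j → y ^ℚ (i ℕ.+ j) ≡ y ^ℚ i · y ^ℚ j
^ℚ-+ y zero    j = sym (ℚ.*-identityˡ (y ^ℚ j))
^ℚ-+ y (suc i) j = trans (cong (y ·_) (^ℚ-+ y i j)) (sym (ℚ.*-assoc y (y ^ℚ i) (y ^ℚ j)))

1ℚ^ℚ : ∀ i → 1ℚ ^ℚ i ≡ 1ℚ
1ℚ^ℚ zero    = refl
1ℚ^ℚ (suc i) = trans (ℚ.*-identityˡ (1ℚ ^ℚ i)) (1ℚ^ℚ i)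

infix 4 _∈_·ℤ
record _∈_·ℤ (y s : ℚ) : Set where
  constructor multiple
  field
    quotient : ℤ
    equality : y ≡ s · ℤtoℚ quotient

·0∈·ℤ : ∀ y {c} → c ≡ 0ℚ → y · c ∈ r ·ℤ
·0∈·ℤ {r} y refl = multiple (+ 0) (trans (ℚ.*-zeroʳ y) (sym (ℚ.*-zeroʳ r)))

∈·ℤ-+ : ∀ {y z} → y ∈ r ·ℤ → z ∈ r ·ℤ → y + z ∈ r ·ℤ
∈·ℤ-+ {r} (multiple t refl) (multiple u refl) = multiple (t ℤ.+ u)
  (trans (sym (ℚ.*-distribˡ-+ r (ℤtoℚ t) (ℤtoℚ u))) (cong (r ·_) (sym (ℤtoℚ-homo-+ t u))))

∈·ℤ-*ˡ : ∀ {z} y → z ∈ r ·ℤ → y · z ∈ (y · r) ·ℤ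
∈·ℤ-*ˡ {r} y (multiple t refl) = multiple t (sym (ℚ.*-assoc y r (ℤtoℚ t)))

·ℤ-⊆ : ∀ {y} → r ∈ r′ ·ℤ → y ∈ r ·ℤ → y ∈ r′ ·ℤ
·ℤ-⊆ {r′ = r′} (multiple t refl) (multiple u refl) = multiple (t ℤ.* u)
  (trans (ℚ.*-assoc r′ (ℤtoℚ t) (ℤtoℚ u)) (cong (r′ ·_) (sym (ℤtoℚ-homo-* t u))))

coeff-+ₚ : ∀ P R e → coeff (P +ₚ R) e ≡ coeff P e + coeff R e
coeff-+ₚ []      R       e       = sym (ℚ.+-identityˡ (coeff R e))
coeff-+ₚ (a ∷ P) []      e       = sym (ℚ.+-identityʳ (coeff (a ∷ P) e))
coeff-+ₚ (a ∷ P) (b ∷ R) zero    = refl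
coeff-+ₚ (a ∷ P) (b ∷ R) (suc e) = coeff-+ₚ P R e

coeff-scaleₚ : ∀ x P e → coeff (scaleₚ x P) e ≡ x · coeff P e
coeff-scaleₚ x []      e       = sym (ℚ.*-zeroʳ x)
coeff-scaleₚ x (a ∷ P) zero    = refl
coeff-scaleₚ x (a ∷ P) (suc e) = coeff-scaleₚ x P e

coeff-+ₚ-zero : ∀ P R {e} → coeff P e ≡ 0ℚ → coeff R e ≡ 0ℚ → coeff (P +ₚ R) e ≡ 0ℚ
coeff-+ₚ-zero P R {e} p≡0 r≡0 = trans (coeff-+ₚ P R e) (cong₂ _+_ p≡0 r≡0)

coeff-scaleₚ-zero : ∀ x P {e} → coeff P e ≡ 0ℚ → coeff (scaleₚ x P) e ≡ 0ℚ
coeff-scaleₚ-zero x P {e} p≡0 =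
  trans (coeff-scaleₚ x P e) (trans (cong (x ·_) p≡0) (ℚ.*-zeroʳ x))

Vanishes : Poly → Set
Vanishes P = ∀ e → coeff P e ≡ 0ℚ

vanishes-0∷ : Vanishes P → Vanishes (0ℚ ∷ P)
vanishes-0∷ P≡0 zero    = refl
vanishes-0∷ P≡0 (suc e) = P≡0 e

vanishes-*ₚ : ∀ P R → Vanishes P → Vanishes (P *ₚ R)
vanishes-*ₚ []      R P≡0 e = refl
vanishes-*ₚ (a ∷ P) R P≡0 e =
  coeff-+ₚ-zero (scaleₚ a R) (0ℚ ∷ (P *ₚ R))
    (trans (coeff-scaleₚ a R e) (trans (cong (_· coeff R e) (P≡0 0)) (ℚ.*-zeroˡ (coeff R e))))
    (vanishes-0∷ (vanishes-*ₚ P R (λ e → P≡0 (suc e))) e)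

DegreeAtMost : ℕ → Poly → Set
DegreeAtMost D P = ∀ e → D < e → coeff P e ≡ 0ℚ

degree-+ₚ : ∀ P R → DegreeAtMost D P → DegreeAtMost D R → DegreeAtMost D (P +ₚ R)
degree-+ₚ P R degP degR e D<e = coeff-+ₚ-zero P R (degP e D<e) (degR e D<e)

degree-scaleₚ : ∀ x P → DegreeAtMost D P → DegreeAtMost D (scaleₚ x P)
degree-scaleₚ x P degP e D<e = coeff-scaleₚ-zero x P (degP e D<e)

-- deg P ≤ D, and the degree-D homogenisation of P evaluated at y = ρ lies in rℤ[x].
record HomogIn (ρ : ℚ) (D : ℕ) (r : ℚ) (P : Poly) : Set where
  constructor homogIn
  field
    degree       : DegreeAtMost D P
    coefficients : ∀ e → e ≤ D → ρ ^ℚ (D ∸ e) · coeff P e ∈ r ·ℤ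

homogIn-vanishing : Vanishes P → HomogIn ρ D r P
homogIn-vanishing {ρ = ρ} {D = D} P≡0 =
  homogIn (λ e _ → P≡0 e) (λ e _ → ·0∈·ℤ (ρ ^ℚ (D ∸ e)) (P≡0 e))

homogIn-+ₚ : HomogIn ρ D r P → HomogIn ρ D r R → HomogIn ρ D r (P +ₚ R)
homogIn-+ₚ {ρ} {D} {r} {P} {R} (homogIn degP inP) (homogIn degR inR) =
  homogIn (degree-+ₚ P R degP degR) in-sum
  where
  in-sum : ∀ e → e ≤ D → ρ ^ℚ (D ∸ e) · coeff (P +ₚ R) e ∈ r ·ℤ
  in-sum e e≤D = subst (_∈ r ·ℤ) distrib (∈·ℤ-+ (inP e e≤D) (inR e e≤D))
    where
    distrib : ρ ^ℚ (D ∸ e) · coeff P e + ρ ^ℚ (D ∸ e) · coeff R e ≡ ρ ^ℚ (D ∸ e) · coeff (P +ₚ R) e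
    distrib = trans (sym (ℚ.*-distribˡ-+ (ρ ^ℚ (D ∸ e)) (coeff P e) (coeff R e)))
                    (cong (ρ ^ℚ (D ∸ e) ·_) (sym (coeff-+ₚ P R e)))

homogIn-0∷ : HomogIn ρ D r P → HomogIn ρ (suc D) r (0ℚ ∷ P)
homogIn-0∷ {ρ} {D} {r} {P} (homogIn degP inP) = homogIn degree in-shift
  where
  degree : DegreeAtMost (suc D) (0ℚ ∷ P)
  degree (suc e) (s≤s D<e) = degP e D<e
  in-shift : ∀ e → e ≤ suc D → ρ ^ℚ (suc D ∸ e) · coeff (0ℚ ∷ P) e ∈ r ·ℤ
  in-shift zero    _         = ·0∈·ℤ (ρ ^ℚ suc D) refl
  in-shift (suc e) (s≤s e≤D) = inP e e≤D

homogIn-tail : HomogIn ρ (suc D) r (a ∷ P) → HomogIn ρ D r P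
homogIn-tail (homogIn deg in∷) =
  homogIn (λ e D<e → deg (suc e) (s≤s D<e)) (λ e e≤D → in∷ (suc e) (s≤s e≤D))

homogIn-raise : ∀ D′ → HomogIn ρ D r P → HomogIn ρ (D′ ℕ.+ D) (ρ ^ℚ D′ · r) P
homogIn-raise {ρ} {D} {r} {P} D′ (homogIn degP inP) = homogIn degree in-raised
  where
  degree : DegreeAtMost (D′ ℕ.+ D) P
  degree e D′+D<e = degP e (ℕ.≤-<-trans (ℕ.m≤n+m D D′) D′+D<e)
  in-raised : ∀ e → e ≤ D′ ℕ.+ D → ρ ^ℚ (D′ ℕ.+ D ∸ e) · coeff P e ∈ (ρ ^ℚ D′ · r) ·ℤ
  in-raised e _ with e ℕ.≤? D
  ... | no  e≰D = ·0∈·ℤ (ρ ^ℚ (D′ ℕ.+ D ∸ e)) (degP e (ℕ.≰⇒> e≰D))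
  ... | yes e≤D = subst (_∈ (ρ ^ℚ D′ · r) ·ℤ) exponent (∈·ℤ-*ˡ (ρ ^ℚ D′) (inP e e≤D))
    where
    exponent : ρ ^ℚ D′ · (ρ ^ℚ (D ∸ e) · coeff P e) ≡ ρ ^ℚ (D′ ℕ.+ D ∸ e) · coeff P e
    exponent = begin
      ρ ^ℚ D′ · (ρ ^ℚ (D ∸ e) · coeff P e)  ≡⟨ ℚ.*-assoc (ρ ^ℚ D′) (ρ ^ℚ (D ∸ e)) (coeff P e) ⟨
      ρ ^ℚ D′ · ρ ^ℚ (D ∸ e) · coeff P e    ≡⟨ cong (_· coeff P e) (^ℚ-+ ρ D′ (D ∸ e)) ⟨
      ρ ^ℚ (D′ ℕ.+ (D ∸ e)) · coeff P e     ≡⟨ cong (λ j → ρ ^ℚ j · coeff P e) (ℕ.+-∸-assoc D′ e≤D) ⟨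
      ρ ^ℚ (D′ ℕ.+ D ∸ e) · coeff P e       ∎
      where open ≡-Reasoning

homogIn-scaleₚ : ∀ x → x · r ∈ r′ ·ℤ → HomogIn ρ D r P → HomogIn ρ D r′ (scaleₚ x P)
homogIn-scaleₚ {r} {r′} {ρ} {D} {P} x xr∈r′ℤ (homogIn degP inP) =
  homogIn (degree-scaleₚ x P degP) in-scaled
  where
  in-scaled : ∀ e → e ≤ D → ρ ^ℚ (D ∸ e) · coeff (scaleₚ x P) e ∈ r′ ·ℤ
  in-scaled e e≤D = ·ℤ-⊆ xr∈r′ℤ (subst (_∈ (x · r) ·ℤ) swap (∈·ℤ-*ˡ x (inP e e≤D)))
    where
    swap : x · (ρ ^ℚ (D ∸ e) · coeff P e) ≡ ρ ^ℚ (D ∸ e) · coeff (scaleₚ x P) e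
    swap = trans (x∙yz≈y∙xz x (ρ ^ℚ (D ∸ e)) (coeff P e))
                 (cong (ρ ^ℚ (D ∸ e) ·_) (sym (coeff-scaleₚ x P e)))

homogIn-scaleₚ-head : ∀ {r₁ r₂} → HomogIn ρ D₁ r₁ (a ∷ P) → HomogIn ρ D₂ r₂ R →
                      HomogIn ρ (D₁ ℕ.+ D₂) (r₁ · r₂) (scaleₚ a R)
homogIn-scaleₚ-head {ρ} {D₁} {a} {r₁ = r₁} {r₂} (homogIn _ in∷) homR =
  homogIn-scaleₚ a head∈ (homogIn-raise D₁ homR)
  where
  head∈ : a · (ρ ^ℚ D₁ · r₂) ∈ (r₁ · r₂) ·ℤ
  head∈ = subst₂ _∈_·ℤ (x∙yz≈z∙yx r₂ (ρ ^ℚ D₁) a) (ℚ.*-comm r₂ r₁) (∈·ℤ-*ˡ r₂ (in∷ 0 z≤n))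

homogIn-*ₚ : ∀ {r₁ r₂} P R → HomogIn ρ D₁ r₁ P → HomogIn ρ D₂ r₂ R →
             HomogIn ρ (D₁ ℕ.+ D₂) (r₁ · r₂) (P *ₚ R)
homogIn-*ₚ []      R _    _    = homogIn-vanishing (λ _ → refl)
homogIn-*ₚ {D₁ = zero} (a ∷ P) R homP homR =
  homogIn-+ₚ (homogIn-scaleₚ-head homP homR) (homogIn-vanishing (vanishes-0∷ (vanishes-*ₚ P R P≡0)))
  where
  P≡0 : Vanishes P
  P≡0 e = HomogIn.degree homP (suc e) (s≤s z≤n)
homogIn-*ₚ {D₁ = suc D₁} (a ∷ P) R homP homR =
  homogIn-+ₚ (homogIn-scaleₚ-head homP homR)
             (homogIn-0∷ (homogIn-*ₚ P R (homogIn-tail homP) homR))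

homogIn-constₚ-1ℚ : HomogIn ρ 0 1ℚ (constₚ 1ℚ)
homogIn-constₚ-1ℚ = homogIn (λ { (suc e) _ → refl }) (λ { zero _ → multiple (+ 1) refl })

homogIn-^ₚ : ∀ L n → HomogIn ρ 1 r L → HomogIn ρ n (r ^ℚ n) (L ^ₚ n)
homogIn-^ₚ L zero    _    = homogIn-constₚ-1ℚ
homogIn-^ₚ L (suc n) homL = homogIn-*ₚ L (L ^ₚ n) homL (homogIn-^ₚ L n homL)

degree-linₚ : ∀ u v → DegreeAtMost 1 (linₚ u v)
degree-linₚ u v (suc zero)    (s≤s ())
degree-linₚ u v (suc (suc e)) _ = refl

homogIn-linₚ : ∀ w u v → HomogIn (ℤtoℚ w) 1 1ℚ (linₚ u v)
homogIn-linₚ w u v = homogIn (degree-linₚ u v) λ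
  { zero          _ → multiple (w ℤ.* v) (trans (cong (_· ℤtoℚ v) (ℚ.*-identityʳ (ℤtoℚ w)))
                        (trans (sym (ℤtoℚ-homo-* w v)) (sym (ℚ.*-identityˡ _))))
  ; (suc zero)    _ → multiple u refl
  ; (suc (suc e)) (s≤s ()) }

homogIn-linₚ-∣ : ∀ {w c} d → w ∣ c → HomogIn (ℤtoℚ w) 1 (ℤtoℚ w) (linₚ c d)
homogIn-linₚ-∣ {w} {c} d (divides z c≡zw) = homogIn (degree-linₚ c d) λ
  { zero          _ → multiple d (cong (_· ℤtoℚ d) (ℚ.*-identityʳ (ℤtoℚ w)))
  ; (suc zero)    _ → multiple z (begin
      1ℚ · ℤtoℚ c          ≡⟨ ℚ.*-identityˡ (ℤtoℚ c) ⟩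
      ℤtoℚ c               ≡⟨ cong ℤtoℚ c≡zw ⟩
      ℤtoℚ (z ℤ.* w)       ≡⟨ ℤtoℚ-homo-* z w ⟩
      ℤtoℚ z · ℤtoℚ w      ≡⟨ ℚ.*-comm (ℤtoℚ z) (ℤtoℚ w) ⟩
      ℤtoℚ w · ℤtoℚ z      ∎)
  ; (suc (suc e)) (s≤s ()) }
  where open ≡-Reasoning

slashBasis : ℤ → ℤ → ℤ → ℤ → ℕ → ℕ → Poly
slashBasis a b c d K n = (linₚ c d ^ₚ n) *ₚ (linₚ a b ^ₚ (K ∸ n))

homogIn-slashBasis : ∀ {w c} a b d {K} → w ∣ c → n ≤ K →
                     HomogIn (ℤtoℚ w) K (ℤtoℚ w ^ℚ n) (slashBasis a b c d K n)
homogIn-slashBasis {n} {w} {c} a b d {K} w∣c n≤K =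
  subst₂ (λ D r → HomogIn (ℤtoℚ w) D r (slashBasis a b c d K n))
    (ℕ.m+[n∸m]≡n n≤K)
    (trans (cong (ℤtoℚ w ^ℚ n ·_) (1ℚ^ℚ (K ∸ n))) (ℚ.*-identityʳ (ℤtoℚ w ^ℚ n)))
    (homogIn-*ₚ (linₚ c d ^ₚ n) (linₚ a b ^ₚ (K ∸ n))
      (homogIn-^ₚ (linₚ c d) n (homogIn-linₚ-∣ d w∣c))
      (homogIn-^ₚ (linₚ a b) (K ∸ n) (homogIn-linₚ w a b)))

homogIn-slashTerm : ∀ {w c m α} a b d {K} → w ∣ c → n ≤ K → ℤtoℚ w ^ℚ suc n · α ∈ m ·ℤ →
                    HomogIn (ℤtoℚ w) (suc K) m (scaleₚ α (slashBasis a b c d K n))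
homogIn-slashTerm {n} {w} {m = m} {α} a b d w∣c n≤K wⁿ⁺¹α∈mℤ =
  homogIn-scaleₚ α (subst (_∈ m ·ℤ) reorder wⁿ⁺¹α∈mℤ)
    (homogIn-raise 1 (homogIn-slashBasis a b d w∣c n≤K))
  where
  reorder : ℤtoℚ w ^ℚ suc n · α ≡ α · (ℤtoℚ w ^ℚ 1 · ℤtoℚ w ^ℚ n)
  reorder = trans (ℚ.*-comm (ℤtoℚ w ^ℚ suc n) α)
    (cong (λ y → α · (y · ℤtoℚ w ^ℚ n)) (sym (ℚ.*-identityʳ (ℤtoℚ w))))

sumTo-closed : (Good : Poly → Set) → (∀ {P R} → Good P → Good R → Good (P +ₚ R)) →
               ∀ N f → (∀ n → n ≤ N → Good (f n)) → Good (sumTo N f)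
sumTo-closed Good +-closed zero    f good = good zero z≤n
sumTo-closed Good +-closed (suc N) f good =
  +-closed (sumTo-closed Good +-closed N f (λ n n≤N → good n (ℕ.m≤n⇒m≤1+n n≤N)))
           (good (suc N) ℕ.≤-refl)

InP-coefficient : ∀ {k m q P} → InP k m q P → n ≤ k ∸ 2 →
                  ℤtoℚ (+ q) ^ℚ suc n · aCoeff k P n ∈ m ·ℤ
InP-coefficient {n} (_ , coefficients) n≤K with coefficients n n≤K
... | t , eq = multiple t eq

suc-∸-∸ : ∀ {K n} → n ≤ K → suc K ∸ (K ∸ n) ≡ suc n
suc-∸-∸ {K} {n} n≤K = trans (ℕ.+-∸-assoc 1 (ℕ.m∸n≤m K n)) (cong suc (ℕ.m∸[m∸n]≡n n≤K))

homogIn⇒InP : ∀ {k m q S} → DegreeAtMost (k ∸ 2) S →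
              HomogIn (ℤtoℚ (+ q)) (suc (k ∸ 2)) m S → InP k m q S
homogIn⇒InP {k} {m} {q} {S} deg (homogIn _ coefficients) = deg , coefficient
  where
  K : ℕ
  K = k ∸ 2
  coefficient : ∀ n → n ≤ K → ∃ λ t → ℤtoℚ (+ q) ^ℚ suc n · aCoeff k S n ≡ m · ℤtoℚ t
  coefficient n n≤K
    with subst (λ j → ℤtoℚ (+ q) ^ℚ j · coeff S (K ∸ n) ∈ m ·ℤ) (suc-∸-∸ n≤K)
               (coefficients (K ∸ n) (ℕ.m≤n⇒m≤1+n (ℕ.m∸n≤m K n)))
  ... | multiple t eq = t , eq

mainTheorem13 : (k q₁ q₂ : ℕ) → 2 ≤ k → 1 ≤ q₁ → 1 ≤ q₂ → (m : ℚ) →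
    (P₀ : Poly) → InP k m q₁ P₀ →
    (a b c d : ℤ) → InΓ₀ (q₁ * q₂) a b c d →
    InP k m q₁ (slash k P₀ a b c d)
mainTheorem13 k q₁ q₂ _ _ _ m P₀ P₀∈𝒫 a b c d (_ , q₁q₂∣c) =
  homogIn⇒InP {k} {m} {q₁} {slash k P₀ a b c d}
    (sumTo-closed (DegreeAtMost K) (λ {P} {R} → degree-+ₚ P R) K term degree)
    (sumTo-closed (HomogIn (ℤtoℚ (+ q₁)) (suc K) m) homogIn-+ₚ K term homog)
  where
  K : ℕ
  K = k ∸ 2
  term : ℕ → Poly
  term n = scaleₚ (aCoeff k P₀ n) (slashBasis a b c d K n)
  q₁∣c : + q₁ ∣ c
  q₁∣c = ∣ᵤ⇒∣ {+ q₁} {c} (ℕ.∣-trans (ℕ.m∣m*n q₂) q₁q₂∣c)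
  degree : ∀ n → n ≤ K → DegreeAtMost K (term n)
  degree n n≤K = degree-scaleₚ (aCoeff k P₀ n) (slashBasis a b c d K n)
                   (HomogIn.degree (homogIn-slashBasis a b d q₁∣c n≤K))
  homog : ∀ n → n ≤ K → HomogIn (ℤtoℚ (+ q₁)) (suc K) m (term n)
  homog n n≤K =
    homogIn-slashTerm a b d q₁∣c n≤K (InP-coefficient {n} {k} {m} {q₁} {P₀} P₀∈𝒫 n≤K)
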